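{- Let $G_c=(V,E_c)$ be a transitively closed directed acyclic graph on $n$ nodes and let $\gamma>0$ be a parameter. Let $\mathcal{S}$ be the set of super-layers of $G_c$ with respect to $\gamma$ (defined in the context) and let $E_1=\bigcup_{S\in\mathcal{S}}(S\times S)\cap E_c$. Then there is an assignment of labels $\ell_1(\cdot)$ to the nodes of $V$, each consisting of $\mathcal{O}(\log n+n/\gamma)$ bits, such that given $\ell_1(u)$ and $\ell_1(v)$ one can check in constant time whether $(u,v)\in E_1$.
   Context: For $v\in V$ let $d[v]$ be the number of edges of a longest directed path in $G_c$ ending at $v$, and for $i\ge1$ let $U_i=\{v\in V: d[v]=i-1\}$; the nonempty sets $U_1,\dots,U_k$ (the layers) partition $V$ into antichains. A layer $U_i$ is thick if $|U_i|>n/\gamma$ and thin otherwise. Super-layers are formed by scanning the layers in the order $U_1,U_2,\dots,U_k$: each thick layer forms its own super-layer, while maximal runs of consecutive thin layers are glued into super-layers greedily, adding the next thin layer to the current super-layer until its total size exceeds $n/\gamma$ (then a new super-layer is started) or a thick layer is encountered. Constant time refers to the Word RAM model with words of $\Theta(\log n)$ bits and labels stored as arrays of words accessible in constant time; the checking procedure uses only the two labels.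
   Formalization: The parameter γ ranges over the positive rationals. -}

module Defs where

open import Data.Nat using (ℕ; zero; suc; _+_; _*_; _∸_; _^_; _≤_; _<_; _<ᵇ_; _≡ᵇ_)
open import Data.Nat.DivMod using (_/_; _%_)
open import Data.Bool using (Bool; true; false; if_then_else_; not; T)
open import Data.Fin using (Fin)
open import Data.List using (List; []; _∷_; length; filter)
open import Data.List.Base using (lookup)
open import Data.Fin using (fromℕ<)
open import Data.Nat using (_<?_)
open import Data.List using (allFin)
open import Data.Nat.Properties using (_≟_)
open import Data.Product using (Σ; _×_; _,_)
open import Data.Empty using (⊥)
open import Data.Unit using (⊤)
open import Relation.Nullary using (yes; no)
open import Relation.Binary.PropositionalEquality using (_≡_)

Graph : ℕ → Set
Graph n = Fin n → Fin n → Bool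

data Path {n : ℕ} (E : Graph n) : Fin n → Fin n → ℕ → Set where
  here : ∀ {v} → Path E v v 0
  step : ∀ {u w v k} → T (E u w) → Path E w v k → Path E u v (suc k)

TransitivelyClosed : ∀ {n} → Graph n → Set
TransitivelyClosed E = ∀ u v w → T (E u v) → T (E v w) → T (E u w)

Acyclic : ∀ {n} → Graph n → Set
Acyclic E = ∀ v k → Path E v v (suc k) → ⊥

IsLongestPathDepth : ∀ {n} → Graph n → (Fin n → ℕ) → Set
IsLongestPathDepth {n} E d =
  ∀ v → Σ (Fin n) (λ u → Path E u v (d v)) × (∀ u k → Path E u v k → k ≤ d v)

-- Layers and super-layers.  gamma = p / q with p, q ≥ 1 (gamma > 0
-- rational); "|U| > n / gamma" is rendered as  n * q < |U| * p.

-- |U_{i+1}| = number of nodes v with d v = i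
layerSize : ∀ {n} → (Fin n → ℕ) → ℕ → ℕ
layerSize {n} d i = length (filter (λ v → d v ≟ i) (allFin n))

exceeds : (n p q : ℕ) → ℕ → Bool
exceeds n p q m = (n * q) <ᵇ (m * p)

-- state of the greedy scan: current super-layer id, whether the current
-- super-layer is an open run of thin layers that may be extended, and
-- its accumulated size.
record ScanState : Set where
  constructor st
  field
    cur  : ℕ
    open? : Bool
    acc  : ℕ

scanStep : (n p q : ℕ) → ScanState → ℕ → ScanState
scanStep n p q (st c o a) m =
  if exceeds n p q m
  then st (suc c) false 0                              -- thick layer: own super-layer
  else (if o
        then st c (not (exceeds n p q (a + m))) (a + m)    -- glue to current thin run
        else st (suc c) (not (exceeds n p q m)) m)         -- start a new thin run

-- state after processing the layers with depth 0 .. i-1  (U_1 .. U_i)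
scan : ∀ {n} → (Fin n → ℕ) → (p q : ℕ) → ℕ → ScanState
scan d p q zero    = st 0 false 0
scan {n} d p q (suc i) = scanStep n p q (scan d p q i) (layerSize d i)

-- identifier of the super-layer containing the layer of depth i (U_{i+1})
superLayerOf : ∀ {n} → (Fin n → ℕ) → (p q : ℕ) → ℕ → ℕ
superLayerOf d p q i = ScanState.cur (scan d p q (suc i))

E₁ : ∀ {n} → Graph n → (Fin n → ℕ) → (p q : ℕ) → Fin n → Fin n → Set
E₁ E d p q u v = T (E u v) × (superLayerOf d p q (d u) ≡ superLayerOf d p q (d v))

-- A word is a natural < 2 ^ w; a label
-- is an array (list) of words.  A query procedure is a fixed expression
-- over word operations (no loops), reading words of the two labels by
-- index; since the expression is fixed independently of n, its
-- evaluation takes a constant number of word operations.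

data Expr : Set where
  const : ℕ → Expr
  wsize : Expr
  read₁ read₂ : Expr → Expr              -- A₁[e], A₂[e] (0 if out of range)
  len₁ len₂ : Expr
  add sub mul div mod shl shr lt eq : Expr → Expr → Expr
  ite : Expr → Expr → Expr → Expr

divN : ℕ → ℕ → ℕ
divN x zero    = 0
divN x (suc y) = x / suc y

modN : ℕ → ℕ → ℕ
modN x zero    = x
modN x (suc y) = x % suc y

trunc : ℕ → ℕ → ℕ
trunc w x = modN x (2 ^ w)

readAt : List ℕ → ℕ → ℕ
readAt [] i = 0
readAt (x ∷ xs) zero = x
readAt (x ∷ xs) (suc i) = readAt xs i

b2n : Bool → ℕ
b2n true = 1
b2n false = 0

eval : (w : ℕ) → (A₁ A₂ : List ℕ) → Expr → ℕ
eval w A₁ A₂ (const k) = trunc w k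
eval w A₁ A₂ wsize = trunc w w
eval w A₁ A₂ (read₁ e) = trunc w (readAt A₁ (eval w A₁ A₂ e))
eval w A₁ A₂ (read₂ e) = trunc w (readAt A₂ (eval w A₁ A₂ e))
eval w A₁ A₂ len₁ = trunc w (length A₁)
eval w A₁ A₂ len₂ = trunc w (length A₂)
eval w A₁ A₂ (add e f) = trunc w (eval w A₁ A₂ e + eval w A₁ A₂ f)
eval w A₁ A₂ (sub e f) = eval w A₁ A₂ e ∸ eval w A₁ A₂ f
eval w A₁ A₂ (mul e f) = trunc w (eval w A₁ A₂ e * eval w A₁ A₂ f)
eval w A₁ A₂ (div e f) = divN (eval w A₁ A₂ e) (eval w A₁ A₂ f)
eval w A₁ A₂ (mod e f) = modN (eval w A₁ A₂ e) (eval w A₁ A₂ f)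
eval w A₁ A₂ (shl e f) = trunc w (eval w A₁ A₂ e * 2 ^ eval w A₁ A₂ f)
eval w A₁ A₂ (shr e f) = divN (eval w A₁ A₂ e) (2 ^ eval w A₁ A₂ f)
eval w A₁ A₂ (lt e f) = b2n (eval w A₁ A₂ e <ᵇ eval w A₁ A₂ f)
eval w A₁ A₂ (eq e f) = b2n (eval w A₁ A₂ e ≡ᵇ eval w A₁ A₂ f)
eval w A₁ A₂ (ite c e f) with eval w A₁ A₂ c
... | zero  = eval w A₁ A₂ f
... | suc _ = eval w A₁ A₂ e

Label : ℕ → Set
Label w = List ℕ

WellFormedLabel : (w : ℕ) → List ℕ → Set
WellFormedLabel w [] = ⊤
WellFormedLabel w (x ∷ xs) = (x < 2 ^ w) × WellFormedLabel w xs

bits : (w : ℕ) → List ℕ → ℕ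
bits w A = length A * w

-- Inside a super-layer, number the nodes layer by layer; an edge of E₁ runs from
-- one layer of the super-layer to a strictly later one, and every layer after the
-- first of a super-layer is thin and is preceded by thin layers of total size at
-- most n/γ, so the target of an edge of E₁ has position below 2n/γ. The label of u
-- holds an identifier of its super-layer, its position, and a row of about 2n/γ
-- bits whose k-th bit records an edge from u to the node at position k of its
-- super-layer; the query compares the identifiers and reads the bit of u's row at
-- the position of v.

module Submission where

open import Defs
open import Data.Nat using (ℕ; zero; suc; _+_; _*_; _∸_; _^_; _≤_; _<_; _≡ᵇ_; _≤′_; ≤′-refl; ≤′-step;
                            NonZero; z≤n; s≤s; s≤s⁻¹; _<?_; ⌊_/2⌋; ⌈_/2⌉)
open import Data.Nat.Properties
open import Data.Nat.DivMod
open import Data.Nat.Logarithm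
open import Data.Nat.Solver using (module +-*-Solver)
open import Data.Bool using (Bool; true; false; T)
open import Data.Bool.Properties using (T?)
open import Data.Fin using (Fin; toℕ; zero)
open import Data.Fin.Properties using (any?; toℕ-injective; toℕ<n)
open import Data.List using (List; []; _∷_; length; filter; allFin; applyUpTo)
open import Data.List.Properties using (filter-some; length-filter; length-tabulate; length-applyUpTo)
open import Data.List.Membership.Propositional.Properties using (∈-allFin)
open import Data.List.Relation.Unary.Any as Any using (Any)
open import Data.Product using (Σ; ∃; _×_; _,_; proj₁; proj₂)
open import Data.Unit using (tt)
open import Function using (_∘_)
open import Function.Bundles using (_⇔_; mk⇔)
open import Relation.Nullary using (¬_; ¬?; Dec; yes; no; contradiction)
open import Relation.Nullary.Decidable using (_×-dec_; isYes; fromWitness; toWitness)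
open import Relation.Unary using (Pred; Decidable; _⊆_)
open import Relation.Binary.PropositionalEquality
open import Relation.Binary.Definitions using (tri<; tri≈; tri>)

module _ {a p q r} {A : Set a} {P : Pred A p} {Q : Pred A q} {R : Pred A r}
         (P? : Decidable P) (Q? : Decidable Q) (R? : Decidable R) where

  length-filter-disjoint : (∀ {x} → P x → ¬ Q x) → P ⊆ R → Q ⊆ R → ∀ xs →
    length (filter P? xs) + length (filter Q? xs) ≤ length (filter R? xs)
  length-filter-disjoint disjoint P⊆R Q⊆R [] = z≤n
  length-filter-disjoint disjoint P⊆R Q⊆R (x ∷ xs)
    with ih ← length-filter-disjoint disjoint P⊆R Q⊆R xs | P? x | Q? x | R? x
  ... | yes Px | yes Qx | _     = contradiction Qx (disjoint Px)
  ... | yes _  | no _   | yes _ = s≤s ih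
  ... | yes Px | no _   | no ¬Rx = contradiction (P⊆R Px) ¬Rx
  ... | no _   | yes _  | yes _ rewrite +-suc (length (filter P? xs)) (length (filter Q? xs)) = s≤s ih
  ... | no _   | yes Qx | no ¬Rx = contradiction (Q⊆R Qx) ¬Rx
  ... | no _   | no _   | yes _ = m≤n⇒m≤1+n ih
  ... | no _   | no _   | no _  = ih

module _ {a p r} {A : Set a} {P : Pred A p} {R : Pred A r}
         (P? : Decidable P) (R? : Decidable R) where

  length-filter-< : P ⊆ R → ∀ {xs} → Any (λ x → R x × ¬ P x) xs →
    length (filter P? xs) < length (filter R? xs)
  length-filter-< P⊆R {xs} witness = begin-strict
    length (filter P? xs)                             <⟨ m<m+n _ (filter-some R∧¬P? witness) ⟩
    length (filter P? xs) + length (filter R∧¬P? xs)  ≤⟨ length-filter-disjoint P? R∧¬P? R? (λ Px (_ , ¬Px) → ¬Px Px) P⊆R proj₁ xs ⟩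
    length (filter R? xs)                             ∎
    where
    open ≤-Reasoning
    R∧¬P? : Decidable (λ x → R x × ¬ P x)
    R∧¬P? x = R? x ×-dec ¬? (P? x)

-- Greedy scan and super-layers

open ScanState

module _ (n p q : ℕ) where

  scanStep-cur-≤ : ∀ s m → cur s ≤ cur (scanStep n p q s m)
  scanStep-cur-≤ (st c o a) m with exceeds n p q m | o
  ... | true  | _     = n≤1+n c
  ... | false | true  = ≤-refl
  ... | false | false = n≤1+n c

  scanStep-acc-≤ : ∀ s m → acc (scanStep n p q s m) ≤ acc s + m
  scanStep-acc-≤ (st c o a) m with exceeds n p q m | o
  ... | true  | _     = z≤n
  ... | false | true  = ≤-refl
  ... | false | false = m≤n+m m a

  scanStep-glue : ∀ s m → cur (scanStep n p q s m) ≡ cur s →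
    exceeds n p q m ≡ false × open? s ≡ true × acc (scanStep n p q s m) ≡ acc s + m
  scanStep-glue (st c o a) m same with exceeds n p q m | o
  ... | true  | _     = contradiction same (1+n≢n)
  ... | false | true  = refl , refl , refl
  ... | false | false = contradiction same (1+n≢n)

  scanStep-open : ∀ s m → open? (scanStep n p q s m) ≡ true →
    m ≤ acc (scanStep n p q s m) × exceeds n p q (acc (scanStep n p q s m)) ≡ false
  scanStep-open (st c o a) m _ with exceeds n p q m in thin | o
  ... | false | false = ≤-refl , thin
  ... | false | true  with exceeds n p q (a + m)
  ...   | false = m≤n+m m a , refl

thin⇒≤ : ∀ n p q m → exceeds n p q m ≡ false → m * p ≤ n * q
thin⇒≤ n p q m thin = ≮⇒≥ (λ nq<mp → subst T thin (<⇒<ᵇ nq<mp))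

module SuperLayers {n : ℕ} (d : Fin n → ℕ) (p q : ℕ) where

  C A : ℕ → ℕ
  C i = cur (scan d p q i)
  A i = acc (scan d p q i)

  M : ℕ → ℕ
  M = layerSize d

  superLayer : Fin n → ℕ
  superLayer x = superLayerOf d p q (d x)

  -- total size of the layers preceding layer i in its super-layer
  offset : ℕ → ℕ
  offset i = A (suc i) ∸ M i

  C-step : ∀ i → C i ≤ C (suc i)
  C-step i = scanStep-cur-≤ n p q (scan d p q i) (M i)

  glue : ∀ i → C (suc i) ≡ C i →
    exceeds n p q (M i) ≡ false × open? (scan d p q i) ≡ true × A (suc i) ≡ A i + M i
  glue i = scanStep-glue n p q (scan d p q i) (M i)

  C-mono : ∀ {i j} → i ≤ j → C i ≤ C j
  C-mono i≤j = go (≤⇒≤′ i≤j)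
    where
    go : ∀ {i j} → i ≤′ j → C i ≤ C j
    go ≤′-refl                    = ≤-refl
    go {j = suc j} (≤′-step i≤j) = ≤-trans (go i≤j) (C-step j)

  C-between : ∀ {i j k} → i ≤ k → k ≤ j → C i ≡ C j → C k ≡ C j
  C-between {k = k} i≤k k≤j Ci≡Cj = ≤-antisym (C-mono k≤j) (subst (_≤ C k) Ci≡Cj (C-mono i≤k))

  A-mono : ∀ {i j} → i ≤ j → C i ≡ C j → A i ≤ A j
  A-mono i≤j = go (≤⇒≤′ i≤j)
    where
    go : ∀ {i j} → i ≤′ j → C i ≡ C j → A i ≤ A j
    go ≤′-refl _ = ≤-refl
    go {i} {suc j} (≤′-step i≤j) Ci≡Cj+1 = begin
      A i        ≤⟨ go i≤j (trans Ci≡Cj+1 (sym Cj≡Cj+1)) ⟩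
      A j        ≤⟨ m≤m+n (A j) (M j) ⟩
      A j + M j  ≡⟨ proj₂ (proj₂ (glue j (sym Cj≡Cj+1))) ⟨
      A (suc j)  ∎
      where
      open ≤-Reasoning
      Cj≡Cj+1 : C j ≡ C (suc j)
      Cj≡Cj+1 = C-between (≤′⇒≤ i≤j) (n≤1+n j) Ci≡Cj+1

  nodesBelow : ℕ → ℕ
  nodesBelow i = length (filter (λ v → d v <? i) (allFin n))

  nodesBelow-suc : ∀ i → nodesBelow i + M i ≤ nodesBelow (suc i)
  nodesBelow-suc i = length-filter-disjoint (λ v → d v <? i) (λ v → d v ≟ i) (λ v → d v <? suc i)
    <⇒≢ m<n⇒m<1+n (λ dv≡i → ≤-reflexive (cong suc dv≡i)) (allFin n)

  A-≤-nodesBelow : ∀ i → A i ≤ nodesBelow i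
  A-≤-nodesBelow zero    = z≤n
  A-≤-nodesBelow (suc i) = begin
    A (suc i)              ≤⟨ scanStep-acc-≤ n p q (scan d p q i) (M i) ⟩
    A i + M i              ≤⟨ +-monoˡ-≤ (M i) (A-≤-nodesBelow i) ⟩
    nodesBelow i + M i     ≤⟨ nodesBelow-suc i ⟩
    nodesBelow (suc i)     ∎
    where open ≤-Reasoning

  offset+M-≤-n : ∀ i → offset i + M i ≤ n
  offset+M-≤-n i = begin
    offset i + M i         ≤⟨ +-monoˡ-≤ (M i) offset-≤-A ⟩
    A i + M i              ≤⟨ +-monoˡ-≤ (M i) (A-≤-nodesBelow i) ⟩
    nodesBelow i + M i     ≤⟨ nodesBelow-suc i ⟩
    nodesBelow (suc i)     ≤⟨ length-filter (λ v → d v <? suc i) (allFin n) ⟩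
    length (allFin n)      ≡⟨ length-tabulate (λ v → v) ⟩
    n                      ∎
    where
    open ≤-Reasoning
    offset-≤-A : offset i ≤ A i
    offset-≤-A = m≤n+o⇒m∸n≤o (A (suc i)) (M i)
      (subst (A (suc i) ≤_) (+-comm (A i) (M i)) (scanStep-acc-≤ n p q (scan d p q i) (M i)))

  open-thin : ∀ i → open? (scan d p q i) ≡ true → exceeds n p q (A i) ≡ false
  open-thin (suc i) isOpen = proj₂ (scanStep-open n p q (scan d p q i) (M i) isOpen)

  module _ {i j} (i<j : i < j) (same : C (suc i) ≡ C (suc j)) where

    private
      Cj+1≡Cj : C (suc j) ≡ C j
      Cj+1≡Cj = sym (C-between i<j (n≤1+n j) same)

      Ci+2≡Ci+1 : C (suc (suc i)) ≡ C (suc i)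
      Ci+2≡Ci+1 = trans (C-between (n≤1+n (suc i)) (s≤s i<j) same) (sym same)

      glue-j : exceeds n p q (M j) ≡ false × open? (scan d p q j) ≡ true × A (suc j) ≡ A j + M j
      glue-j = glue j Cj+1≡Cj

      offset-j : offset j ≡ A j
      offset-j = trans (cong (_∸ M j) (proj₂ (proj₂ glue-j))) (m+n∸n≡m (A j) (M j))

    offset-separated : offset i + M i ≤ offset j
    offset-separated = begin
      offset i + M i  ≡⟨ m∸n+n≡m M-i≤A-i+1 ⟩
      A (suc i)       ≤⟨ A-mono i<j (trans same Cj+1≡Cj) ⟩
      A j             ≡⟨ offset-j ⟨
      offset j        ∎
      where
      open ≤-Reasoning
      M-i≤A-i+1 : M i ≤ A (suc i)
      M-i≤A-i+1 = proj₁ (scanStep-open n p q (scan d p q i) (M i) (proj₁ (proj₂ (glue (suc i) Ci+2≡Ci+1))))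

    offset-thin : (offset j + M j) * p ≤ 2 * (n * q)
    offset-thin = begin
      (offset j + M j) * p  ≡⟨ cong (λ o → (o + M j) * p) offset-j ⟩
      (A j + M j) * p       ≡⟨ *-distribʳ-+ p (A j) (M j) ⟩
      A j * p + M j * p     ≤⟨ +-mono-≤ (thin⇒≤ n p q (A j) (open-thin j (proj₁ (proj₂ glue-j))))
                                        (thin⇒≤ n p q (M j) (proj₁ glue-j)) ⟩
      n * q + n * q         ≡⟨ cong (n * q +_) (+-identityʳ (n * q)) ⟨
      2 * (n * q)           ∎
      where open ≤-Reasoning

  before? : (x : Fin n) → Decidable (λ y → d y ≡ d x × toℕ y < toℕ x)
  before? x y = d y ≟ d x ×-dec toℕ y <? toℕ x

  rank : Fin n → ℕ
  rank x = length (filter (before? x) (allFin n))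

  pos : Fin n → ℕ
  pos x = offset (d x) + rank x

  private
    ∈-allFin-with : ∀ {ℓ} {P : Pred (Fin n) ℓ} x → P x → Any P (allFin n)
    ∈-allFin-with x Px = Any.map (λ { refl → Px }) (∈-allFin x)

    not-before-self : ∀ x → ¬ (d x ≡ d x × toℕ x < toℕ x)
    not-before-self x (_ , x<x) = <-irrefl refl x<x

  rank-<-M : ∀ x → rank x < M (d x)
  rank-<-M x = length-filter-< (before? x) (λ y → d y ≟ d x) proj₁
    (∈-allFin-with x (refl , not-before-self x))

  rank-strict : ∀ {x y} → d x ≡ d y → toℕ x < toℕ y → rank x < rank y
  rank-strict {x} {y} dx≡dy x<y = length-filter-< (before? x) (before? y)
    (λ (dz≡dx , z<x) → trans dz≡dx dx≡dy , <-trans z<x x<y)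
    (∈-allFin-with x ((dx≡dy , x<y) , not-before-self x))

  rank-injective : ∀ {x y} → d x ≡ d y → rank x ≡ rank y → x ≡ y
  rank-injective {x} {y} dx≡dy rank≡ with <-cmp (toℕ x) (toℕ y)
  ... | tri< x<y _ _ = contradiction rank≡ (<⇒≢ (rank-strict dx≡dy x<y))
  ... | tri≈ _ x≡y _ = toℕ-injective x≡y
  ... | tri> _ _ y<x = contradiction (sym rank≡) (<⇒≢ (rank-strict (sym dx≡dy) y<x))

  pos-<-offset+M : ∀ x → pos x < offset (d x) + M (d x)
  pos-<-offset+M x = +-monoʳ-< (offset (d x)) (rank-<-M x)

  pos-< : ∀ x → pos x < n
  pos-< x = <-≤-trans (pos-<-offset+M x) (offset+M-≤-n (d x))

  pos-separated : ∀ {x y} → d x < d y → superLayer x ≡ superLayer y → pos x < pos y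
  pos-separated {x} {y} dx<dy same = begin-strict
    pos x                   <⟨ pos-<-offset+M x ⟩
    offset (d x) + M (d x)  ≤⟨ offset-separated dx<dy same ⟩
    offset (d y)            ≤⟨ m≤m+n (offset (d y)) (rank y) ⟩
    pos y                   ∎
    where open ≤-Reasoning

  pos-injective : ∀ {x y} → superLayer x ≡ superLayer y → pos x ≡ pos y → x ≡ y
  pos-injective {x} {y} same pos≡ with <-cmp (d x) (d y)
  ... | tri< dx<dy _ _ = contradiction pos≡ (<⇒≢ (pos-separated dx<dy same))
  ... | tri≈ _ dx≡dy _ = rank-injective dx≡dy
    (+-cancelˡ-≡ (offset (d x)) (rank x) (rank y) (trans pos≡ (cong (λ i → offset i + rank y) (sym dx≡dy))))
  ... | tri> _ _ dy<dx = contradiction (sym pos≡) (<⇒≢ (pos-separated dy<dx (sym same)))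

  pos-bound : ∀ {x y} → d x < d y → superLayer x ≡ superLayer y → pos y * p ≤ 2 * (n * q)
  pos-bound {y = y} dx<dy same =
    ≤-trans (*-monoˡ-≤ p (<⇒≤ (pos-<-offset+M y))) (offset-thin dx<dy same)

-- Words and bit rows

divN≡/ : ∀ x y .{{_ : NonZero y}} → divN x y ≡ x / y
divN≡/ x (suc y) = refl

modN-small : ∀ {x y} → x < y → modN x y ≡ x
modN-small {y = suc y} x<y = m<n⇒m%n≡m x<y

trunc-small : ∀ w {x} → x < 2 ^ w → trunc w x ≡ x
trunc-small w = modN-small

n<2^n : ∀ n → n < 2 ^ n
n<2^n zero    = s≤s z≤n
n<2^n (suc n) = +-mono-≤ (m^n>0 2 n) (subst (n <_) (sym (+-identityʳ (2 ^ n))) (n<2^n n))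

b2n≤1 : ∀ b → b2n b ≤ 1
b2n≤1 true  = s≤s z≤n
b2n≤1 false = z≤n

b2n-T : ∀ {b} → T b → b2n b ≡ 1
b2n-T {true} _ = refl

b2n-¬T : ∀ {b} → ¬ T b → b2n b ≡ 0
b2n-¬T {false} _ = refl
b2n-¬T {true}  ¬T = contradiction tt ¬T

b2n-≢0 : ∀ {b} → b2n b ≢ 0 → T b
b2n-≢0 {true}  _    = tt
b2n-≢0 {false} b≢0 = contradiction refl b≢0

bitAt : ℕ → ℕ → ℕ
bitAt x k = modN (divN x (2 ^ k)) 2

encode : ℕ → (ℕ → Bool) → ℕ
encode zero    f = 0
encode (suc w) f = b2n (f 0) + 2 * encode w (f ∘ suc)

encode-< : ∀ w f → encode w f < 2 ^ w
encode-< zero    f = s≤s z≤n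
encode-< (suc w) f = begin-strict
  b2n (f 0) + 2 * e  <⟨ +-monoˡ-< (2 * e) (s≤s (b2n≤1 (f 0))) ⟩
  2 + 2 * e          ≡⟨ *-distribˡ-+ 2 1 e ⟨
  2 * suc e          ≤⟨ *-monoʳ-≤ 2 (encode-< w (f ∘ suc)) ⟩
  2 * 2 ^ w          ∎
  where
  open ≤-Reasoning
  e : ℕ
  e = encode w (f ∘ suc)

private
  bit+2*-/2 : ∀ b e → (b2n b + 2 * e) / 2 ≡ e
  bit+2*-/2 false e = trans (cong (_/ 2) (*-comm 2 e)) (m*n/n≡m e 2)
  bit+2*-/2 true  e = begin
    (1 + 2 * e) / 2  ≡⟨ cong (λ x → (1 + x) / 2) (*-comm 2 e) ⟩
    (1 + e * 2) / 2  ≡⟨ +-distrib-/ 1 (e * 2) (subst (λ r → 1 + r < 2) (sym (m*n%n≡0 e 2)) (s≤s (s≤s z≤n))) ⟩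
    0 + e * 2 / 2    ≡⟨ m*n/n≡m e 2 ⟩
    e                ∎
    where open ≡-Reasoning

  bit+2*-%2 : ∀ b e → (b2n b + 2 * e) % 2 ≡ b2n b
  bit+2*-%2 b e = trans (cong (λ x → (b2n b + x) % 2) (*-comm 2 e))
                        (trans ([m+kn]%n≡m%n (b2n b) e 2) (m<n⇒m%n≡m (s≤s (b2n≤1 b))))

  divN-2^-suc : ∀ x k → divN x (2 ^ suc k) ≡ divN (x / 2) (2 ^ k)
  divN-2^-suc x k = begin
    divN x (2 ^ suc k)   ≡⟨ divN≡/ x (2 ^ suc k) ⟩
    x / (2 * 2 ^ k)      ≡⟨ m/n/o≡m/[n*o] x 2 (2 ^ k) ⟨
    x / 2 / 2 ^ k        ≡⟨ divN≡/ (x / 2) (2 ^ k) ⟨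
    divN (x / 2) (2 ^ k) ∎
    where
    open ≡-Reasoning
    instance
      2^k≢0 : NonZero (2 ^ k)
      2^k≢0 = m^n≢0 2 k
      2^k+1≢0 : NonZero (2 ^ suc k)
      2^k+1≢0 = m^n≢0 2 (suc k)

bitAt-encode : ∀ w f k → k < w → bitAt (encode w f) k ≡ b2n (f k)
bitAt-encode (suc w) f zero    _ =
  trans (cong (_% 2) (n/1≡n (encode (suc w) f))) (bit+2*-%2 (f 0) (encode w (f ∘ suc)))
bitAt-encode (suc w) f (suc k) (s≤s k<w) = begin
  modN (divN (encode (suc w) f) (2 ^ suc k)) 2            ≡⟨ cong (λ x → modN x 2) (divN-2^-suc (encode (suc w) f) k) ⟩
  modN (divN (encode (suc w) f / 2) (2 ^ k)) 2            ≡⟨ cong (λ x → bitAt x k) (bit+2*-/2 (f 0) (encode w (f ∘ suc))) ⟩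
  bitAt (encode w (f ∘ suc)) k                            ≡⟨ bitAt-encode w (f ∘ suc) k k<w ⟩
  b2n (f (suc k))                                         ∎
  where open ≡-Reasoning

bitAt-0 : ∀ k → bitAt 0 k ≡ 0
bitAt-0 k = cong (λ x → modN x 2) (trans (divN≡/ 0 (2 ^ k) {{m^n≢0 2 k}}) (0/n≡0 (2 ^ k) {{m^n≢0 2 k}}))

readAt-applyUpTo : ∀ (g : ℕ → ℕ) {L j} → j < L → readAt (applyUpTo g L) j ≡ g j
readAt-applyUpTo g {suc L} {zero}  _         = refl
readAt-applyUpTo g {suc L} {suc j} (s≤s j<L) = readAt-applyUpTo (g ∘ suc) j<L

readAt-applyUpTo-≥ : ∀ (g : ℕ → ℕ) {L j} → L ≤ j → readAt (applyUpTo g L) j ≡ 0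
readAt-applyUpTo-≥ g {zero}              _         = refl
readAt-applyUpTo-≥ g {suc L} {suc j} (s≤s L≤j) = readAt-applyUpTo-≥ (g ∘ suc) L≤j

applyUpTo-wellFormed : ∀ {w} (g : ℕ → ℕ) L → (∀ j → g j < 2 ^ w) → WellFormedLabel w (applyUpTo g L)
applyUpTo-wellFormed g zero    _   = tt
applyUpTo-wellFormed g (suc L) g< = g< 0 , applyUpTo-wellFormed (g ∘ suc) L (g< ∘ suc)

pack : ℕ → (ℕ → Bool) → ℕ → List ℕ
pack w f L = applyUpTo (λ j → encode w (λ k → f (j * w + k))) L

pack-wellFormed : ∀ w f L → WellFormedLabel w (pack w f L)
pack-wellFormed w f L = applyUpTo-wellFormed _ L (λ j → encode-< w (λ k → f (j * w + k)))

module _ (w : ℕ) .{{_ : NonZero w}} (f : ℕ → Bool) (L i : ℕ) where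

  pack-bit : i / w < L → bitAt (readAt (pack w f L) (i / w)) (i % w) ≡ b2n (f i)
  pack-bit i/w<L = begin
    bitAt (readAt (pack w f L) (i / w)) (i % w)          ≡⟨ cong (λ x → bitAt x (i % w)) (readAt-applyUpTo _ i/w<L) ⟩
    bitAt (encode w (λ k → f (i / w * w + k))) (i % w)   ≡⟨ bitAt-encode w _ (i % w) (m%n<n i w) ⟩
    b2n (f (i / w * w + i % w))                          ≡⟨ cong (b2n ∘ f) (trans (+-comm _ (i % w)) (sym (m≡m%n+[m/n]*n i w))) ⟩
    b2n (f i)                                            ∎
    where open ≡-Reasoning

  pack-bit-beyond : L ≤ i / w → bitAt (readAt (pack w f L) (i / w)) (i % w) ≡ 0
  pack-bit-beyond L≤i/w = trans (cong (λ x → bitAt x (i % w)) (readAt-applyUpTo-≥ _ L≤i/w)) (bitAt-0 (i % w))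

-- The query and the labelling

-- Labels have the shape  id ∷ pos ∷ row : the query compares the ids and
-- then reads bit  pos₂  of  row₁ , i.e. bit  pos₂ % w  of word  2 + pos₂ / w .
queryBit : Expr
queryBit = mod (shr (read₁ (add (const 2) (div (read₂ (const 1)) wsize)))
                    (mod (read₂ (const 1)) wsize))
               (const 2)

idTest : Expr
idTest = eq (read₁ (const 0)) (read₂ (const 0))

query : Expr
query = ite idTest queryBit (const 0)

eval-ite-≢0 : ∀ w A B c e f → eval w A B c ≢ 0 → eval w A B (ite c e f) ≡ eval w A B e
eval-ite-≢0 w A B c e f c≢0 with eval w A B c
... | zero  = contradiction refl c≢0
... | suc _ = refl

eval-ite-≡0 : ∀ w A B c e f → eval w A B c ≡ 0 → eval w A B (ite c e f) ≡ eval w A B f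
eval-ite-≡0 w A B c e f c≡0 with eval w A B c
... | zero = refl

module Query (w' : ℕ) where

  W : ℕ
  W = suc (suc w')

  private
    4≤2^W : 4 ≤ 2 ^ W
    4≤2^W = *-monoʳ-≤ 2 (*-monoʳ-≤ 2 (m^n>0 2 w'))

  index-< : ∀ x → 2 + x ≤ 2 ^ W → 2 + x / W < 2 ^ W
  index-< x 2+x≤2^W = *-cancelˡ-≤ 2 (begin
    2 * (3 + x / W)     ≡⟨ *-distribˡ-+ 2 3 (x / W) ⟩
    6 + 2 * (x / W)     ≤⟨ +-monoʳ-≤ 6 (*-monoʳ-≤ 2 (/-monoʳ-≤ x {W} {2} (s≤s (s≤s z≤n)))) ⟩
    6 + 2 * (x / 2)     ≡⟨ cong (6 +_) (*-comm 2 (x / 2)) ⟩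
    6 + x / 2 * 2       ≤⟨ +-monoʳ-≤ 6 (m/n*n≤m x 2) ⟩
    4 + (2 + x)         ≤⟨ +-mono-≤ 4≤2^W 2+x≤2^W ⟩
    2 ^ W + 2 ^ W       ≡⟨ cong (2 ^ W +_) (+-identityʳ (2 ^ W)) ⟨
    2 * 2 ^ W           ∎)
    where open ≤-Reasoning

  module _ {r₁ p₁ r₂ p₂ : ℕ} {V₁ V₂ : List ℕ}
           (r₁< : r₁ < 2 ^ W) (r₂< : r₂ < 2 ^ W) (p₂< : 2 + p₂ ≤ 2 ^ W) (V₁-wf : WellFormedLabel W V₁) where

    private
      A₁ A₂ : List ℕ
      A₁ = r₁ ∷ p₁ ∷ V₁
      A₂ = r₂ ∷ p₂ ∷ V₂

      small-< : ∀ k → k ≤ 2 → k < 2 ^ W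
      small-< k k≤2 = <-≤-trans (s≤s k≤2) (≤-trans (n≤1+n 3) 4≤2^W)

      small : ∀ k → k ≤ 2 → trunc W k ≡ k
      small k k≤2 = trunc-small W (small-< k k≤2)

      readAt-wf : ∀ {V} i → WellFormedLabel W V → readAt V i < 2 ^ W
      readAt-wf {[]}    _       _          = m^n>0 2 W
      readAt-wf {_ ∷ _} zero    (x< , _)   = x<
      readAt-wf {_ ∷ _} (suc i) (_ , V-wf) = readAt-wf i V-wf

      read : ∀ V i → i < 2 ^ W → readAt V i < 2 ^ W → trunc W (readAt V (trunc W i)) ≡ readAt V i
      read V i i< Vi< = trans (cong (trunc W ∘ readAt V) (trunc-small W i<)) (trunc-small W Vi<)

      eval-ids : eval W A₁ A₂ idTest ≡ b2n (r₁ ≡ᵇ r₂)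
      eval-ids = cong₂ (λ a b → b2n (a ≡ᵇ b)) (read A₁ 0 (m^n>0 2 W) r₁<) (read A₂ 0 (m^n>0 2 W) r₂<)

      -- the unfolding of  eval W A₁ A₂ queryBit , with the values of  const 2 ,
      -- read₂ (const 1)  and  wsize  abstracted
      queryBit-with : ℕ → ℕ → ℕ → ℕ
      queryBit-with two pos w = modN (divN (trunc W (readAt A₁ (trunc W (two + divN pos w)))) (2 ^ modN pos w)) two

      eval-queryBit : eval W A₁ A₂ queryBit ≡ bitAt (readAt V₁ (p₂ / W)) (p₂ % W)
      eval-queryBit = begin
        queryBit-with (trunc W 2) (trunc W (readAt A₂ (trunc W 1))) (trunc W W)
          ≡⟨ cong₂ (λ two pos → queryBit-with two pos (trunc W W)) (small 2 ≤-refl) (read A₂ 1 (small-< 1 (s≤s z≤n)) (<-trans (n<1+n p₂) p₂<)) ⟩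
        queryBit-with 2 p₂ (trunc W W)
          ≡⟨ cong (queryBit-with 2 p₂) (trunc-small W (n<2^n W)) ⟩
        queryBit-with 2 p₂ W
          ≡⟨ cong (λ x → bitAt x (p₂ % W)) (read A₁ (2 + p₂ / W) (index-< p₂ p₂<) (readAt-wf (p₂ / W) V₁-wf)) ⟩
        bitAt (readAt V₁ (p₂ / W)) (p₂ % W) ∎
        where open ≡-Reasoning

    query-same-id : r₁ ≡ r₂ → eval W A₁ A₂ query ≡ bitAt (readAt V₁ (p₂ / W)) (p₂ % W)
    query-same-id refl = trans (eval-ite-≢0 W A₁ A₂ idTest queryBit (const 0) ids≢0) eval-queryBit
      where
      ids≢0 : eval W A₁ A₂ idTest ≢ 0
      ids≢0 = subst (_≢ 0) (sym (trans eval-ids (b2n-T (≡⇒≡ᵇ r₁ r₁ refl)))) (λ ())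

    query-other-id : r₁ ≢ r₂ → eval W A₁ A₂ query ≡ 0
    query-other-id r₁≢r₂ = trans (eval-ite-≡0 W A₁ A₂ idTest queryBit (const 0) ids≡0) (small 0 z≤n)
      where
      ids≡0 : eval W A₁ A₂ idTest ≡ 0
      ids≡0 = trans eval-ids (b2n-¬T (r₁≢r₂ ∘ ≡ᵇ⇒≡ r₁ r₂))

⌈log₂⌉≤⇒≤2^ : ∀ w m → ⌈log₂ m ⌉ ≤ w → m ≤ 2 ^ w
⌈log₂⌉≤⇒≤2^ zero zero          _  = z≤n
⌈log₂⌉≤⇒≤2^ zero (suc zero)    _  = s≤s z≤n
⌈log₂⌉≤⇒≤2^ zero (suc (suc m)) lg≤0 =
  contradiction (≤-trans (⌈log₂⌉-mono-≤ {2} {suc (suc m)} (s≤s (s≤s z≤n))) lg≤0) λ ()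
⌈log₂⌉≤⇒≤2^ (suc w) m lg≤w+1 = begin
  m                  ≡⟨ ⌊n/2⌋+⌈n/2⌉≡n m ⟨
  ⌊ m /2⌋ + ⌈ m /2⌉  ≤⟨ +-monoˡ-≤ ⌈ m /2⌉ (⌊n/2⌋≤⌈n/2⌉ m) ⟩
  ⌈ m /2⌉ + ⌈ m /2⌉  ≤⟨ +-mono-≤ half≤ half≤ ⟩
  2 ^ w + 2 ^ w      ≡⟨ cong (2 ^ w +_) (+-identityʳ (2 ^ w)) ⟨
  2 ^ suc w          ∎
  where
  open ≤-Reasoning
  half≤ : ⌈ m /2⌉ ≤ 2 ^ w
  half≤ = ⌈log₂⌉≤⇒≤2^ w ⌈ m /2⌉ (subst (_≤ w) (sym (⌈log₂⌈n/2⌉⌉≡⌈log₂n⌉∸1 m)) (∸-monoˡ-≤ 1 lg≤w+1))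

label-size-bound : ∀ K lg W p M t nq → W ≤ K * lg → t * W ≤ M → M * p ≤ 2 * nq →
  (2 + (t + 1)) * W * p ≤ (3 * K + 2) * (lg * p + nq)
label-size-bound K lg W p M t nq W≤Klg tW≤M Mp≤2nq = begin
  (2 + (t + 1)) * W * p                  ≡⟨ solve 3 (λ t W p → (con 2 :+ (t :+ con 1)) :* W :* p
                                                    := t :* W :* p :+ con 3 :* (W :* p)) refl t W p ⟩
  t * W * p + 3 * (W * p)                ≤⟨ +-mono-≤ (*-monoˡ-≤ p tW≤M) (*-monoʳ-≤ 3 (*-monoˡ-≤ p W≤Klg)) ⟩
  M * p + 3 * (K * lg * p)               ≤⟨ +-monoˡ-≤ _ Mp≤2nq ⟩
  2 * nq + 3 * (K * lg * p)              ≤⟨ m≤m+n _ (3 * K * nq + 2 * (lg * p)) ⟩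
  2 * nq + 3 * (K * lg * p) + (3 * K * nq + 2 * (lg * p))
                                         ≡⟨ solve 4 (λ K lg p nq → con 2 :* nq :+ con 3 :* (K :* lg :* p) :+ (con 3 :* K :* nq :+ con 2 :* (lg :* p))
                                                    := (con 3 :* K :+ con 2) :* (lg :* p :+ nq)) refl K lg p nq ⟩
  (3 * K + 2) * (lg * p + nq)            ∎
  where
  open ≤-Reasoning
  open +-*-Solver

snoc : ∀ {n} {E : Graph n} {u v w k} → Path E u v k → T (E v w) → Path E u w (suc k)
snoc here           e = step e here
snoc (step e′ path) e = step e′ (snoc path e)

depth-increases : ∀ {n} {E : Graph n} {d} → IsLongestPathDepth E d → ∀ {u v} → T (E u v) → d u < d v
depth-increases {d = d} depth {u} {v} e with depth u
... | (source , path) , _ with depth v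
...   | _ , longest = longest source (suc (d u)) (snoc path e)

no-edges-below-2 : ∀ {n} {E : Graph n} → Acyclic E → n ≤ 1 → ∀ u v → ¬ T (E u v)
no-edges-below-2 acyclic (s≤s z≤n) zero zero e = acyclic zero 0 (step e here)

module _ {n : ℕ} (f : Fin n → ℕ) where

  -- Super-layer numbers need not be below n, so a super-layer is identified by
  -- the index of one of its nodes.
  firstWith : ℕ → ℕ
  firstWith s with any? (λ y → f y ≟ s)
  ... | yes (y , _) = toℕ y
  ... | no _        = 0

  firstWith-spec : ∀ u → Σ (Fin n) λ y → f y ≡ f u × firstWith (f u) ≡ toℕ y
  firstWith-spec u with any? (λ y → f y ≟ f u)
  ... | yes (y , fy≡fu) = y , fy≡fu , refl
  ... | no  ∄y          = contradiction (u , refl) ∄y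

  firstWith-< : ∀ u → firstWith (f u) < n
  firstWith-< u with firstWith-spec u
  ... | y , _ , first≡y = subst (_< n) (sym first≡y) (toℕ<n y)

  firstWith-injective : ∀ {u v} → firstWith (f u) ≡ firstWith (f v) → f u ≡ f v
  firstWith-injective {u} {v} first≡ with firstWith-spec u | firstWith-spec v
  ... | y , fy≡fu , fu≡y | y′ , fy′≡fv , fv≡y′ with toℕ-injective (trans (sym fu≡y) (trans first≡ fv≡y′))
  ...   | refl = trans (sym fy≡fu) fy′≡fv

LabelScheme : ℕ → Expr → ∀ {n} → Graph n → (Fin n → ℕ) → (p q w : ℕ) → Set
LabelScheme c P {n} E d p q w = Σ (Fin n → List ℕ) λ ℓ₁ →
  (∀ v → WellFormedLabel w (ℓ₁ v)) ×
  (∀ v → bits w (ℓ₁ v) * p ≤ c * (⌈log₂ (n + 1) ⌉ * p + n * q)) ×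
  (∀ u v → E₁ E d p q u v ⇔ (eval w (ℓ₁ u) (ℓ₁ v) P ≢ 0))

emptyLabels : ∀ c P {n} {E : Graph n} {d p q w} → (∀ u v → ¬ T (E u v)) → eval w [] [] P ≡ 0 →
  LabelScheme c P E d p q w
emptyLabels c P no-edges P≡0 = (λ _ → []) , (λ _ → tt) , (λ _ → z≤n) ,
  λ u v → mk⇔ (λ (e , _) → contradiction e (no-edges u v)) (λ P≢0 → contradiction P≡0 P≢0)

module Labelling {n : ℕ} (E : Graph n) {d : Fin n → ℕ} (depth : IsLongestPathDepth E d)
                 (p q w′ : ℕ) .{{_ : NonZero p}} (n<2^W : n < 2 ^ suc (suc w′)) where

  open SuperLayers d p q
  open Query w′

  rowLength : ℕ
  rowLength = 2 * (n * q) / p / W + 1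

  row? : ∀ u k → Dec (∃ λ x → pos x ≡ k × T (E u x) × superLayer x ≡ superLayer u)
  row? u k = any? λ x → pos x ≟ k ×-dec T? (E u x) ×-dec superLayer x ≟ superLayer u

  row : Fin n → ℕ → Bool
  row u k = isYes (row? u k)

  label : Fin n → List ℕ
  label u = firstWith superLayer (superLayer u) ∷ pos u ∷ pack W (row u) rowLength

  label-wellFormed : ∀ u → WellFormedLabel W (label u)
  label-wellFormed u = <-trans (firstWith-< superLayer u) n<2^W , <-trans (pos-< u) n<2^W ,
                       pack-wellFormed W (row u) rowLength

  label-size : ∀ K → W ≤ K * ⌈log₂ (n + 1) ⌉ → ∀ u →
    bits W (label u) * p ≤ (3 * K + 2) * (⌈log₂ (n + 1) ⌉ * p + n * q)
  label-size K W≤Klg u rewrite length-applyUpTo (λ j → encode W (λ k → row u (j * W + k))) rowLength =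
    label-size-bound K ⌈log₂ (n + 1) ⌉ W p (2 * (n * q) / p) (2 * (n * q) / p / W) (n * q)
      W≤Klg (m/n*n≤m (2 * (n * q) / p) W) (m/n*n≤m (2 * (n * q)) p)

  row-complete : ∀ {u v} → E₁ E d p q u v → T (row u (pos v))
  row-complete {v = v} (e , same) = fromWitness {a? = row? _ (pos v)} (v , refl , e , sym same)

  row-sound : ∀ {u v} → superLayer u ≡ superLayer v → T (row u (pos v)) → T (E u v)
  row-sound {u} {v} same bit with toWitness {a? = row? u (pos v)} bit
  ... | x , pos≡ , e , same′ = subst (T ∘ E u) (pos-injective (trans same′ same) pos≡) e

  row-covers-edges : ∀ {u v} → E₁ E d p q u v → pos v / W < rowLength
  row-covers-edges {v = v} (e , same) = begin-strict
    pos v / W                ≤⟨ /-monoˡ-≤ W pos≤ ⟩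
    2 * (n * q) / p / W      <⟨ m<m+n _ (s≤s z≤n) ⟩
    rowLength                ∎
    where
    open ≤-Reasoning
    pos≤ : pos v ≤ 2 * (n * q) / p
    pos≤ = subst (_≤ 2 * (n * q) / p) (m*n/n≡m (pos v) p)
             (/-monoˡ-≤ p (pos-bound (depth-increases depth e) same))

  private
    query-same-layer : ∀ u v → firstWith superLayer (superLayer u) ≡ firstWith superLayer (superLayer v) →
      eval W (label u) (label v) query ≡ bitAt (readAt (pack W (row u) rowLength) (pos v / W)) (pos v % W)
    query-same-layer u v = query-same-id (<-trans (firstWith-< superLayer u) n<2^W)
      (<-trans (firstWith-< superLayer v) n<2^W) (≤-trans (s≤s (pos-< v)) n<2^W) (pack-wellFormed W (row u) rowLength)

    query-other-layer : ∀ u v → firstWith superLayer (superLayer u) ≢ firstWith superLayer (superLayer v) →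
      eval W (label u) (label v) query ≡ 0
    query-other-layer u v = query-other-id (<-trans (firstWith-< superLayer u) n<2^W)
      (<-trans (firstWith-< superLayer v) n<2^W) (≤-trans (s≤s (pos-< v)) n<2^W) (pack-wellFormed W (row u) rowLength)

  label-correct : ∀ u v → E₁ E d p q u v ⇔ (eval W (label u) (label v) query ≢ 0)
  label-correct u v = mk⇔ forward backward
    where
    forward : E₁ E d p q u v → eval W (label u) (label v) query ≢ 0
    forward uv∈E₁@(_ , same) query≡0 = contradiction (begin
      1                         ≡⟨ b2n-T (row-complete uv∈E₁) ⟨
      b2n (row u (pos v))       ≡⟨ pack-bit W (row u) rowLength (pos v) (row-covers-edges uv∈E₁) ⟨
      bitAt _ (pos v % W)       ≡⟨ query-same-layer u v (cong (firstWith superLayer) same) ⟨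
      eval W (label u) (label v) query ≡⟨ query≡0 ⟩
      0                         ∎) λ ()
      where open ≡-Reasoning

    backward : eval W (label u) (label v) query ≢ 0 → E₁ E d p q u v
    backward query≢0 with firstWith superLayer (superLayer u) ≟ firstWith superLayer (superLayer v)
    ... | no ids≢ = contradiction (query-other-layer u v ids≢) query≢0
    ... | yes ids≡ with pos v / W <? rowLength
    ...   | no beyond = contradiction (trans (query-same-layer u v ids≡)
                          (pack-bit-beyond W (row u) rowLength (pos v) (≮⇒≥ beyond))) query≢0
    ...   | yes within = row-sound same (b2n-≢0 λ bit≡0 → query≢0 (trans (query-same-layer u v ids≡)
                           (trans (pack-bit W (row u) rowLength (pos v) within) bit≡0))) , same
      where same = firstWith-injective superLayer ids≡

n<2^w : ∀ {n w} → ⌈log₂ (n + 1) ⌉ ≤ w → n < 2 ^ w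
n<2^w {n} {w} lg≤w = subst (_≤ 2 ^ w) (+-comm n 1) (⌈log₂⌉≤⇒≤2^ w (n + 1) lg≤w)

lemma8 : (K : ℕ) → Σ ℕ λ c → Σ Expr λ P →
  ∀ (n : ℕ) (E : Graph n) → TransitivelyClosed E → Acyclic E →
  (d : Fin n → ℕ) → IsLongestPathDepth E d →
  (p q : ℕ) → NonZero p → NonZero q →
  (w : ℕ) → ⌈log₂ (n + 1) ⌉ ≤ w → w ≤ K * ⌈log₂ (n + 1) ⌉ →
  Σ (Fin n → List ℕ) λ ℓ₁ →
    (∀ v → WellFormedLabel w (ℓ₁ v)) ×
    (∀ v → bits w (ℓ₁ v) * p ≤ c * (⌈log₂ (n + 1) ⌉ * p + n * q)) ×
    (∀ u v → E₁ E d p q u v ⇔ (eval w (ℓ₁ u) (ℓ₁ v) P ≢ 0))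
lemma8 K = 3 * K + 2 , query , scheme
  where
  scheme : ∀ n (E : Graph n) → TransitivelyClosed E → Acyclic E → ∀ d → IsLongestPathDepth E d →
    ∀ p q → NonZero p → NonZero q → ∀ w → ⌈log₂ (n + 1) ⌉ ≤ w → w ≤ K * ⌈log₂ (n + 1) ⌉ →
    LabelScheme (3 * K + 2) query E d p q w
  scheme n E _ acyclic d _ p q _ _ zero lg≤w _ =
    emptyLabels (3 * K + 2) query (no-edges-below-2 acyclic (<⇒≤ (n<2^w lg≤w))) refl
  scheme n E _ acyclic d _ p q _ _ (suc zero) lg≤w _ =
    emptyLabels (3 * K + 2) query (no-edges-below-2 acyclic (s≤s⁻¹ (n<2^w lg≤w))) refl
  scheme n E _ _ d depth p q p≢0 _ (suc (suc w′)) lg≤w w≤Klg =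
    label , label-wellFormed , label-size K w≤Klg , label-correct
    where open Labelling E depth p q w′ {{p≢0}} (n<2^w lg≤w)
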